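{- Let $n$ be a positive integer. For every positive integer $k$, $$(-1)^{n-1}\sum_{j=1}^k(-1)^jS(k,j)\,(n)_j=\sum_{\alpha\vDash n}(-1)^{\ell(\alpha)}\binom{n}{\alpha}\sum_{i=1}^{\ell(\alpha)}\alpha_i^k,$$ where the sum on the right is over all compositions $\alpha=(\alpha_1,\dots,\alpha_{\ell(\alpha)})$ of $n$.
   Context: $S(k,j)$ are Stirling numbers of the second kind; $(n)_j=n(n-1)\cdots(n-j+1)$ is the falling factorial; $\ell(\alpha)$ is the number of parts of the composition $\alpha$; $\binom{n}{\alpha}=\binom{n}{\alpha_1,\dots,\alpha_{\ell(\alpha)}}$ is the multinomial coefficient. -}

module Defs where

open import Data.Nat using (ℕ; zero; suc; _+_; _*_; _∸_; _^_)
open import Data.Nat.Combinatorics using (_C_)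
open import Data.List using (List; []; _∷_; map; concatMap; length)
open import Data.Nat.ListAction using (sum)
open import Data.Integer using (ℤ; +_; -_) renaming (_+_ to _+ℤ_; _*_ to _*ℤ_)

S : ℕ → ℕ → ℕ
S zero    zero    = 1
S zero    (suc j) = 0
S (suc k) zero    = 0
S (suc k) (suc j) = suc j * S k (suc j) + S k j

falling : ℕ → ℕ → ℕ
falling n zero    = 1
falling n (suc j) = falling n j * (n ∸ j)

sgn : ℕ → ℤ
sgn zero    = + 1
sgn (suc m) = - sgn m

range1 : ℕ → List ℕ
range1 zero    = []
range1 (suc k) = range1 k Data.List.++ (suc k ∷ [])

-- compositions: lists of positive integers summing to n.
-- compsF fuel n enumerates them, choosing the first part a ∈ {1..n};
-- fuel ≥ n suffices since each part is ≥ 1.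
compsF : ℕ → ℕ → List (List ℕ)
compsF _ zero = [] ∷ []
compsF zero (suc n) = []
compsF (suc fuel) (suc n) =
  concatMap (λ a → map (a ∷_) (compsF fuel (suc n ∸ a))) (range1 (suc n))

compositions : ℕ → List (List ℕ)
compositions n = compsF n n

multinomial : ℕ → List ℕ → ℕ
multinomial n []       = 1
multinomial n (a ∷ as) = (n C a) * multinomial (n ∸ a) as

sumℤ : List ℤ → ℤ
sumℤ = Data.List.foldr _+ℤ_ (+ 0)

lhs : ℕ → ℕ → ℤ
lhs n k = sgn (n ∸ 1) *ℤ sumℤ (map (λ j → sgn j *ℤ + (S k j * falling n j)) (range1 k))

rhs : ℕ → ℕ → ℤ
rhs n k = sumℤ (map (λ α → sgn (length α) *ℤ + (multinomial n α * sum (map (λ a → a ^ k) α)))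
                    (compositions n))

-- Both sides are compared through the binomial transform  f ↦ (n ↦ Σ_b C(n,b) f(b)),
-- which is injective.  Splitting off the first part of a composition gives a recursion
-- showing that the transform of the right-hand side at n is −(−1)^n Σ_b C(n,b) (−1)^b b^k
-- (the unweighted recursion shows Σ_{α ⊨ m} (−1)^ℓ(α) C(m,α) = (−1)^m on the way).
-- On the left, Σ_b C(n,b) (−1)^b (b)_j vanishes unless n = j, and expanding
-- b^k = Σ_j S(k,j) (b)_j shows that its transform is the same.
module Submission where

open import Defs
open import Data.Nat using (ℕ; _≥_)
open import Relation.Binary.PropositionalEquality using (_≡_)
open import Data.Nat as ℕ using (zero; suc; _∸_; _^_; _≤_; _<_; z≤n; s≤s)
import Data.Nat.Properties as ℕP
open import Data.Nat.Induction using (<-rec)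
open import Data.Nat.Combinatorics using (_C_; nCk≡nC[n∸k]; nCk+nC[k+1]≡[n+1]C[k+1]; nCn≡1; k>n⇒nCk≡0)
open import Data.Nat.ListAction using (sum)
open import Data.Fin using (Fin; toℕ)
open import Data.Fin.Properties using (toℕ<n; toℕ-inject₁; toℕ-fromℕ; opposite-prop)
open import Data.Fin.Permutation using (reverse)
open import Data.Integer using (ℤ; +_; -_; _+_; _*_; -1ℤ)
import Data.Integer.Properties as ℤP
open import Data.Integer.Solver using (module +-*-Solver)
open import Algebra.Properties.Semiring.Sum ℤP.+-*-semiring
  using (sum-syntax; sum⁺-syntax; sum-cong-≗; sum-init-last; sum-replicate-zero; ∑-distrib-+; ∑-comm; *-distribˡ-sum; ∑-permute)
open import Algebra.Properties.AbelianGroup ℤP.+-0-abelianGroup using (∙-cancelˡ)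
open import Algebra.Properties.CommutativeSemigroup ℤP.*-commutativeSemigroup
  using () renaming (x∙yz≈y∙xz to x*[y*z]≡y*[x*z])
open import Algebra.Properties.CommutativeSemigroup ℤP.+-commutativeSemigroup
  using () renaming (interchange to [x+y]+[z+w]≡[x+z]+[y+w])
open import Algebra.Properties.CommutativeSemigroup ℕP.+-commutativeSemigroup
  using () renaming (x∙yz≈y∙xz to x+[y+z]≡y+[x+z])
open import Data.List using (List; []; _∷_; map; concatMap; length; _++_; [_])
import Data.List.Properties as LP
open import Function using (_∘_)
open import Relation.Binary.PropositionalEquality
  using (_≗_; _≢_; refl; sym; trans; cong; cong₂; module ≡-Reasoning)
open import Relation.Nullary using (yes; no; contradiction)

open +-*-Solver

sgn-+ : ∀ a b → sgn (a ℕ.+ b) ≡ sgn a * sgn b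
sgn-+ zero    b = sym (ℤP.*-identityˡ (sgn b))
sgn-+ (suc a) b = trans (cong -_ (sgn-+ a b)) (ℤP.neg-distribˡ-* (sgn a) (sgn b))

sgn*sgn≡1 : ∀ a → sgn a * sgn a ≡ + 1
sgn*sgn≡1 zero    = refl
sgn*sgn≡1 (suc a) = trans (solve 1 (λ s → (:- s) :* (:- s) := s :* s) refl (sgn a)) (sgn*sgn≡1 a)

sgn-∸ : ∀ {n i} → i ≤ n → sgn (n ∸ i) ≡ sgn n * sgn i
sgn-∸ {n} {i} i≤n = begin
  sgn (n ∸ i)                         ≡⟨ sym (ℤP.*-identityʳ _) ⟩
  sgn (n ∸ i) * + 1                   ≡⟨ cong (sgn (n ∸ i) *_) (sym (sgn*sgn≡1 i)) ⟩
  sgn (n ∸ i) * (sgn i * sgn i)       ≡⟨ sym (ℤP.*-assoc (sgn (n ∸ i)) (sgn i) (sgn i)) ⟩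
  sgn (n ∸ i) * sgn i * sgn i         ≡⟨ cong (_* sgn i) (sym (sgn-+ (n ∸ i) i)) ⟩
  sgn (n ∸ i ℕ.+ i) * sgn i           ≡⟨ cong (λ m → sgn m * sgn i) (ℕP.m∸n+n≡m i≤n) ⟩
  sgn n * sgn i                       ∎
  where open ≡-Reasoning

falling-suc-suc : ∀ b j → falling (suc b) (suc j) ≡ suc b ℕ.* falling b j
falling-suc-suc b zero    = trans (ℕP.*-identityˡ (suc b)) (sym (ℕP.*-identityʳ (suc b)))
falling-suc-suc b (suc j) = trans (cong (ℕ._* (b ∸ j)) (falling-suc-suc b j)) (ℕP.*-assoc (suc b) (falling b j) (b ∸ j))

falling-vanishes : ∀ {b j} → b ≤ j → falling b (suc j) ≡ 0
falling-vanishes {b} {j} b≤j = trans (cong (falling b j ℕ.*_) (ℕP.m≤n⇒m∸n≡0 b≤j)) (ℕP.*-zeroʳ (falling b j))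

b*falling : ∀ b j → b ℕ.* falling b j ≡ falling b (suc j) ℕ.+ j ℕ.* falling b j
b*falling b j with j ℕ.≤? b
... | yes j≤b = begin
  b ℕ.* falling b j                                ≡⟨ cong (ℕ._* falling b j) (sym (ℕP.m∸n+n≡m j≤b)) ⟩
  (b ∸ j ℕ.+ j) ℕ.* falling b j                    ≡⟨ ℕP.*-distribʳ-+ (falling b j) (b ∸ j) j ⟩
  (b ∸ j) ℕ.* falling b j ℕ.+ j ℕ.* falling b j    ≡⟨ cong (ℕ._+ j ℕ.* falling b j) (ℕP.*-comm (b ∸ j) (falling b j)) ⟩
  falling b (suc j) ℕ.+ j ℕ.* falling b j          ∎
  where open ≡-Reasoning
b*falling b zero    | no j≰b = contradiction z≤n j≰b
b*falling b (suc j) | no j≰b rewrite falling-vanishes (ℕP.≤-pred (ℕP.≰⇒> j≰b)) =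
  trans (ℕP.*-zeroʳ b) (sym (ℕP.*-zeroʳ (suc j)))

falling-pascal : ∀ b j → falling (suc b) (suc j) ≡ falling b (suc j) ℕ.+ suc j ℕ.* falling b j
falling-pascal b j = begin
  falling (suc b) (suc j)                                 ≡⟨ falling-suc-suc b j ⟩
  falling b j ℕ.+ b ℕ.* falling b j                       ≡⟨ cong (falling b j ℕ.+_) (b*falling b j) ⟩
  falling b j ℕ.+ (falling b (suc j) ℕ.+ j ℕ.* falling b j)  ≡⟨ x+[y+z]≡y+[x+z] (falling b j) (falling b (suc j)) _ ⟩
  falling b (suc j) ℕ.+ (falling b j ℕ.+ j ℕ.* falling b j)  ∎
  where open ≡-Reasoning

∑-last : ∀ (f : ℕ → ℤ) n → ∑[ i ≤ n ] f (toℕ i) ≡ ∑[ i < n ] f (toℕ i) + f n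
∑-last f n = trans (sum-init-last {n} (f ∘ toℕ)) (cong₂ _+_ (sum-cong-≗ {n} (cong f ∘ toℕ-inject₁)) (cong f (toℕ-fromℕ n)))

∑-reverse : ∀ (f : ℕ → ℤ) n → ∑[ i < n ] f (toℕ i) ≡ ∑[ i < n ] f (n ∸ suc (toℕ i))
∑-reverse f n = trans (∑-permute {n} (f ∘ toℕ) reverse) (sum-cong-≗ {n} (cong f ∘ opposite-prop))

∑-neg : ∀ {n} (f : Fin n → ℤ) → ∑[ i < n ] (- f i) ≡ - ∑[ i < n ] f i
∑-neg f = trans (sum-cong-≗ (sym ∘ ℤP.-1*i≡-i ∘ f)) (trans (sym (*-distribˡ-sum -1ℤ f)) (ℤP.-1*i≡-i _))

-- Stirling numbers

S-vanishes : ∀ {k j} → k < j → S k j ≡ 0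
S-vanishes {zero}  {suc j} _         = refl
S-vanishes {suc k} {suc j} (s≤s k<j)
  rewrite S-vanishes {k} {suc j} (ℕP.m<n⇒m<1+n k<j) | S-vanishes k<j = trans (ℕP.+-identityʳ (j ℕ.* 0)) (ℕP.*-zeroʳ j)

pow≡∑S*falling : ∀ b {k N} → k ≤ N → + (b ^ k) ≡ ∑[ j ≤ N ] (+ S k (toℕ j) * + falling b (toℕ j))
pow≡∑S*falling b {zero} {N} _ =
  sym (cong (_+_ (+ 1)) (trans (sum-cong-≗ {N} (λ j → ℤP.*-zeroˡ (+ falling b (suc (toℕ j))))) (sum-replicate-zero N)))
pow≡∑S*falling b {suc k} {N} k<N = begin
  + (b ^ suc k)                                       ≡⟨ ℤP.pos-* b (b ^ k) ⟩
  + b * + (b ^ k)                                     ≡⟨ cong (+ b *_) (pow≡∑S*falling b (ℕP.<⇒≤ k<N)) ⟩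
  + b * ∑[ j ≤ N ] term (toℕ j)                       ≡⟨ *-distribˡ-sum {suc N} (+ b) (term ∘ toℕ) ⟩
  ∑[ j ≤ N ] (+ b * term (toℕ j))                     ≡⟨ sum-cong-≗ {suc N} (b*term ∘ toℕ) ⟩
  ∑[ j ≤ N ] (lower (toℕ j) + higher (toℕ j))         ≡⟨ ∑-distrib-+ {suc N} (lower ∘ toℕ) (higher ∘ toℕ) ⟩
  ∑[ j ≤ N ] lower (toℕ j) + ∑[ j ≤ N ] higher (toℕ j)
    ≡⟨ cong₂ _+_ top-term-vanishes (ℤP.+-identityˡ _) ⟩
  ∑lower + ∑higher                                    ≡⟨ ℤP.+-comm ∑lower ∑higher ⟩
  ∑higher + ∑lower
    ≡⟨ sym (∑-distrib-+ {N} (higher ∘ suc ∘ toℕ) (lower ∘ toℕ)) ⟩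
  ∑[ j < N ] (higher (suc (toℕ j)) + lower (toℕ j))   ≡⟨ sum-cong-≗ {N} (S-recurrence ∘ toℕ) ⟩
  ∑[ j < N ] (+ S (suc k) (suc (toℕ j)) * F (suc (toℕ j)))  ≡⟨ sym (ℤP.+-identityˡ _) ⟩
  ∑[ j ≤ N ] (+ S (suc k) (toℕ j) * F (toℕ j))        ∎
  where
  open ≡-Reasoning
  s F term lower higher : ℕ → ℤ
  s j = + S k j
  F j = + falling b j
  term j = s j * F j
  lower j = s j * F (suc j)
  higher j = + j * term j
  ∑lower = ∑[ j < N ] lower (toℕ j)
  ∑higher = ∑[ j < N ] higher (suc (toℕ j))

  b*term : ∀ j → + b * term j ≡ lower j + higher j
  b*term j = begin
    + b * (s j * F j)                         ≡⟨ x*[y*z]≡y*[x*z] (+ b) (s j) (F j) ⟩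
    s j * (+ b * F j)                         ≡⟨ cong (s j *_) (sym (ℤP.pos-* b (falling b j))) ⟩
    s j * + (b ℕ.* falling b j)               ≡⟨ cong (λ m → s j * + m) (b*falling b j) ⟩
    s j * + (falling b (suc j) ℕ.+ j ℕ.* falling b j)
      ≡⟨ cong (s j *_) (trans (ℤP.pos-+ (falling b (suc j)) _) (cong (_+_ (F (suc j))) (ℤP.pos-* j (falling b j)))) ⟩
    s j * (F (suc j) + + j * F j)             ≡⟨ ℤP.*-distribˡ-+ (s j) (F (suc j)) _ ⟩
    s j * F (suc j) + s j * (+ j * F j)       ≡⟨ cong (_+_ (s j * F (suc j))) (x*[y*z]≡y*[x*z] (s j) (+ j) (F j)) ⟩
    s j * F (suc j) + + j * (s j * F j)       ∎

  top-term-vanishes : ∑[ j ≤ N ] lower (toℕ j) ≡ ∑lower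
  top-term-vanishes = trans (∑-last lower N)
    (trans (cong (λ m → ∑lower + + m * F (suc N)) (S-vanishes k<N)) (ℤP.+-identityʳ ∑lower))

  S-recurrence : ∀ j → higher (suc j) + lower j ≡ + S (suc k) (suc j) * F (suc j)
  S-recurrence j = begin
    + suc j * (s (suc j) * F (suc j)) + s j * F (suc j)
      ≡⟨ solve 4 (λ c t f u → c :* (t :* f) :+ u :* f := (c :* t :+ u) :* f) refl (+ suc j) (s (suc j)) (F (suc j)) (s j) ⟩
    (+ suc j * s (suc j) + s j) * F (suc j)
      ≡⟨ cong (_* F (suc j)) (sym (trans (ℤP.pos-+ (suc j ℕ.* S k (suc j)) (S k j)) (cong (_+ s j) (ℤP.pos-* (suc j) (S k (suc j)))))) ⟩
    + S (suc k) (suc j) * F (suc j)   ∎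

-- The binomial transform

binomialTransform : (ℕ → ℤ) → ℕ → ℤ
binomialTransform f n = ∑[ b ≤ n ] (+ (n C toℕ b) * f (toℕ b))

binomialTransform-cong : ∀ {f g} → f ≗ g → ∀ n → binomialTransform f n ≡ binomialTransform g n
binomialTransform-cong f≗g n = sum-cong-≗ {suc n} (λ b → cong (+ (n C toℕ b) *_) (f≗g (toℕ b)))

binomialTransform-+ : ∀ f g n →
  binomialTransform (λ b → f b + g b) n ≡ binomialTransform f n + binomialTransform g n
binomialTransform-+ f g n = trans (sum-cong-≗ {suc n} (λ b → ℤP.*-distribˡ-+ (+ (n C toℕ b)) (f (toℕ b)) (g (toℕ b))))
  (∑-distrib-+ {suc n} (λ b → + (n C toℕ b) * f (toℕ b)) (λ b → + (n C toℕ b) * g (toℕ b)))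

binomialTransform-*ˡ : ∀ c f n → binomialTransform (λ b → c * f b) n ≡ c * binomialTransform f n
binomialTransform-*ˡ c f n = trans (sum-cong-≗ {suc n} (λ b → x*[y*z]≡y*[x*z] (+ (n C toℕ b)) c (f (toℕ b))))
  (sym (*-distribˡ-sum {suc n} c (λ b → + (n C toℕ b) * f (toℕ b))))

binomialTransform-neg : ∀ f n → binomialTransform (λ b → - f b) n ≡ - binomialTransform f n
binomialTransform-neg f n = trans (binomialTransform-cong (sym ∘ ℤP.-1*i≡-i ∘ f) n)
  (trans (binomialTransform-*ˡ -1ℤ f n) (ℤP.-1*i≡-i _))

binomialTransform-∑ : ∀ {J} (h : Fin J → ℕ → ℤ) n →
  binomialTransform (λ b → ∑[ j < J ] h j b) n ≡ ∑[ j < J ] binomialTransform (h j) n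
binomialTransform-∑ {J} h n =
  trans (sum-cong-≗ {suc n} (λ b → *-distribˡ-sum {J} (+ (n C toℕ b)) (λ j → h j (toℕ b))))
        (∑-comm {suc n} {J} (λ b j → + (n C toℕ b) * h j (toℕ b)))

binomialTransform-pascal : ∀ f n →
  binomialTransform f (suc n) ≡ binomialTransform f n + binomialTransform (f ∘ suc) n
binomialTransform-pascal f n = begin
  binomialTransform f (suc n)                                ≡⟨⟩
  f₀ + ∑[ b ≤ n ] (+ (suc n C suc (toℕ b)) * f (suc (toℕ b)))
    ≡⟨ cong (_+_ f₀) (sum-cong-≗ {suc n} (pascal ∘ toℕ)) ⟩
  f₀ + ∑[ b ≤ n ] (+ (n C toℕ b) * f (suc (toℕ b)) + upper (toℕ b))
    ≡⟨ cong (_+_ f₀) (∑-distrib-+ {suc n} (λ b → + (n C toℕ b) * f (suc (toℕ b))) (upper ∘ toℕ)) ⟩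
  f₀ + (binomialTransform (f ∘ suc) n + ∑[ b ≤ n ] upper (toℕ b))
    ≡⟨ cong (λ x → f₀ + (binomialTransform (f ∘ suc) n + x)) top-term-vanishes ⟩
  f₀ + (binomialTransform (f ∘ suc) n + ∑upper)
    ≡⟨ solve 3 (λ x y z → x :+ (y :+ z) := x :+ z :+ y) refl f₀ (binomialTransform (f ∘ suc) n) ∑upper ⟩
  binomialTransform f n + binomialTransform (f ∘ suc) n      ∎
  where
  open ≡-Reasoning
  f₀ = + 1 * f 0
  upper : ℕ → ℤ
  upper b = + (n C suc b) * f (suc b)
  ∑upper = ∑[ b < n ] upper (toℕ b)

  pascal : ∀ b → + (suc n C suc b) * f (suc b) ≡ + (n C b) * f (suc b) + upper b
  pascal b = trans (cong (λ c → + c * f (suc b)) (sym (nCk+nC[k+1]≡[n+1]C[k+1] n b)))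
    (trans (cong (_* f (suc b)) (ℤP.pos-+ (n C b) (n C suc b))) (ℤP.*-distribʳ-+ (f (suc b)) (+ (n C b)) (+ (n C suc b))))

  top-term-vanishes : ∑[ b ≤ n ] upper (toℕ b) ≡ ∑upper
  top-term-vanishes = trans (∑-last upper n)
    (trans (cong (λ c → ∑upper + + c * f (suc n)) (k>n⇒nCk≡0 (ℕP.n<1+n n))) (ℤP.+-identityʳ ∑upper))

binomialTransform-last : ∀ f n → binomialTransform f n ≡ ∑[ b < n ] (+ (n C toℕ b) * f (toℕ b)) + f n
binomialTransform-last f n = trans (∑-last (λ b → + (n C b) * f b) n)
  (cong (_+_ (∑[ b < n ] (+ (n C toℕ b) * f (toℕ b)))) (trans (cong (λ c → + c * f n) (nCn≡1 n)) (ℤP.*-identityˡ (f n))))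

binomialTransform-injective : ∀ {u v} → (∀ n → binomialTransform u n ≡ binomialTransform v n) → u ≗ v
binomialTransform-injective {u} {v} Bu≡Bv = <-rec _ λ n u≡v-below →
  ∙-cancelˡ (lower v n) (u n) (v n) (begin
    lower v n + u n        ≡⟨ cong (_+ u n) (sym (lower-agree n u≡v-below)) ⟩
    lower u n + u n        ≡⟨ sym (binomialTransform-last u n) ⟩
    binomialTransform u n  ≡⟨ Bu≡Bv n ⟩
    binomialTransform v n  ≡⟨ binomialTransform-last v n ⟩
    lower v n + v n        ∎)
  where
  open ≡-Reasoning
  lower : (ℕ → ℤ) → ℕ → ℤ
  lower f n = ∑[ b < n ] (+ (n C toℕ b) * f (toℕ b))
  lower-agree : ∀ n → (∀ {m} → m < n → u m ≡ v m) → lower u n ≡ lower v n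
  lower-agree n u≡v-below = sum-cong-≗ {n} (λ b → cong (+ (n C toℕ b) *_) (u≡v-below (toℕ<n b)))

-- The first part i + 1 of a composition of n + 1 leaves a composition of n ∸ i.
binomialTransform-suc : ∀ u n → binomialTransform u (suc n) ≡
  ∑[ i < suc n ] (+ (suc n C suc (toℕ i)) * u (n ∸ toℕ i)) + u (suc n)
binomialTransform-suc u n = trans (binomialTransform-last u (suc n)) (cong (_+ u (suc n))
  (trans (∑-reverse (λ b → + (suc n C b) * u b) (suc n))
         (sum-cong-≗ {suc n} (λ i → cong (λ c → + c * u (n ∸ toℕ i)) (sym (nCk≡nC[n∸k] (toℕ<n i)))))))

binomialTransform-sgn : ∀ n → binomialTransform sgn (suc n) ≡ + 0
binomialTransform-sgn n = trans (binomialTransform-pascal sgn n)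
  (trans (cong (_+_ (binomialTransform sgn n)) (binomialTransform-neg sgn n)) (ℤP.+-inverseʳ (binomialTransform sgn n)))

signedFalling : ℕ → ℕ → ℤ
signedFalling j b = sgn b * + falling b j

signedFalling-suc : ∀ j b → signedFalling (suc j) (suc b) ≡ - (signedFalling (suc j) b + + suc j * signedFalling j b)
signedFalling-suc j b = begin
  - sgn b * + falling (suc b) (suc j)
    ≡⟨ cong (λ m → - sgn b * + m) (falling-pascal b j) ⟩
  - sgn b * + (falling b (suc j) ℕ.+ suc j ℕ.* falling b j)
    ≡⟨ cong (- sgn b *_) (trans (ℤP.pos-+ (falling b (suc j)) _) (cong (_+_ (+ falling b (suc j))) (ℤP.pos-* (suc j) (falling b j)))) ⟩
  - sgn b * (+ falling b (suc j) + + suc j * + falling b j)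
    ≡⟨ solve 4 (λ s x c y → (:- s) :* (x :+ c :* y) := :- (s :* x :+ c :* (s :* y))) refl
         (sgn b) (+ falling b (suc j)) (+ suc j) (+ falling b j) ⟩
  - (signedFalling (suc j) b + + suc j * signedFalling j b) ∎
  where open ≡-Reasoning

binomialTransform-signedFalling : ∀ {j n} → n ≢ j → binomialTransform (signedFalling j) n ≡ + 0
binomialTransform-signedFalling {zero}  {zero}  n≢j = contradiction refl n≢j
binomialTransform-signedFalling {suc j} {zero}  _   rewrite falling-vanishes {0} {j} z≤n = refl
binomialTransform-signedFalling {zero}  {suc n} _   = begin
  binomialTransform g₀ (suc n)                                   ≡⟨ binomialTransform-pascal g₀ n ⟩
  binomialTransform g₀ n + binomialTransform (g₀ ∘ suc) n
    ≡⟨ cong (_+_ (binomialTransform g₀ n)) (binomialTransform-cong (λ b → sym (ℤP.neg-distribˡ-* (sgn b) (+ 1))) n) ⟩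
  binomialTransform g₀ n + binomialTransform (λ b → - g₀ b) n
    ≡⟨ cong (_+_ (binomialTransform g₀ n)) (binomialTransform-neg g₀ n) ⟩
  binomialTransform g₀ n + - binomialTransform g₀ n              ≡⟨ ℤP.+-inverseʳ (binomialTransform g₀ n) ⟩
  + 0                                                            ∎
  where
  open ≡-Reasoning
  g₀ = signedFalling 0
binomialTransform-signedFalling {suc j} {suc n} n+1≢j+1 = begin
  binomialTransform g (suc n)                                    ≡⟨ binomialTransform-pascal g n ⟩
  X + binomialTransform (g ∘ suc) n                              ≡⟨ cong (_+_ X) (binomialTransform-cong (signedFalling-suc j) n) ⟩
  X + binomialTransform (λ b → - (g b + + suc j * signedFalling j b)) n
    ≡⟨ cong (_+_ X) (binomialTransform-neg (λ b → g b + + suc j * signedFalling j b) n) ⟩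
  X + - binomialTransform (λ b → g b + + suc j * signedFalling j b) n
    ≡⟨ cong (λ y → X + - y) (binomialTransform-+ g (λ b → + suc j * signedFalling j b) n) ⟩
  X + - (X + binomialTransform (λ b → + suc j * signedFalling j b) n)
    ≡⟨ cong (λ y → X + - (X + y)) (binomialTransform-*ˡ (+ suc j) (signedFalling j) n) ⟩
  X + - (X + + suc j * binomialTransform (signedFalling j) n)
    ≡⟨ cong (λ y → X + - (X + + suc j * y)) (binomialTransform-signedFalling (n+1≢j+1 ∘ cong suc)) ⟩
  X + - (X + + suc j * + 0)
    ≡⟨ solve 2 (λ x c → x :+ :- (x :+ c :* con (+ 0)) := con (+ 0)) refl X (+ suc j) ⟩
  + 0                                                            ∎
  where
  open ≡-Reasoning
  g = signedFalling (suc j)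
  X = binomialTransform g n

sgn*binomialTransform-signedFalling : ∀ j n →
  sgn n * binomialTransform (signedFalling j) n ≡ sgn j * binomialTransform (signedFalling j) n
sgn*binomialTransform-signedFalling j n with n ℕ.≟ j
... | yes refl = refl
... | no  n≢j  rewrite binomialTransform-signedFalling n≢j = trans (ℤP.*-zeroʳ (sgn n)) (sym (ℤP.*-zeroʳ (sgn j)))

-- Sums over compositions

sumℤ-++ : ∀ xs ys → sumℤ (xs ++ ys) ≡ sumℤ xs + sumℤ ys
sumℤ-++ []       ys = sym (ℤP.+-identityˡ (sumℤ ys))
sumℤ-++ (x ∷ xs) ys = trans (cong (_+_ x) (sumℤ-++ xs ys)) (sym (ℤP.+-assoc x (sumℤ xs) (sumℤ ys)))

sumℤ-map-cong : ∀ {A : Set} {f g : A → ℤ} → f ≗ g → ∀ xs → sumℤ (map f xs) ≡ sumℤ (map g xs)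
sumℤ-map-cong f≗g xs = cong sumℤ (LP.map-cong f≗g xs)

sumℤ-map-*ˡ : ∀ {A : Set} c (f : A → ℤ) xs → sumℤ (map (λ x → c * f x) xs) ≡ c * sumℤ (map f xs)
sumℤ-map-*ˡ c f []       = sym (ℤP.*-zeroʳ c)
sumℤ-map-*ˡ c f (x ∷ xs) =
  trans (cong (_+_ (c * f x)) (sumℤ-map-*ˡ c f xs)) (sym (ℤP.*-distribˡ-+ c (f x) (sumℤ (map f xs))))

sumℤ-map-+ : ∀ {A : Set} (f g : A → ℤ) xs →
  sumℤ (map (λ x → f x + g x) xs) ≡ sumℤ (map f xs) + sumℤ (map g xs)
sumℤ-map-+ f g []       = refl
sumℤ-map-+ f g (x ∷ xs) = trans (cong (_+_ (f x + g x)) (sumℤ-map-+ f g xs))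
  ([x+y]+[z+w]≡[x+z]+[y+w] (f x) (g x) (sumℤ (map f xs)) (sumℤ (map g xs)))

sumℤ-map-concatMap : ∀ {A B : Set} (h : B → ℤ) (F : A → List B) xs →
  sumℤ (map h (concatMap F xs)) ≡ sumℤ (map (λ a → sumℤ (map h (F a))) xs)
sumℤ-map-concatMap h F []       = refl
sumℤ-map-concatMap h F (x ∷ xs) = trans (cong sumℤ (LP.map-++ h (F x) (concatMap F xs)))
  (trans (sumℤ-++ (map h (F x)) _) (cong (_+_ (sumℤ (map h (F x)))) (sumℤ-map-concatMap h F xs)))

sumℤ-map-range1 : ∀ (f : ℕ → ℤ) n → sumℤ (map f (range1 n)) ≡ ∑[ i < n ] f (suc (toℕ i))
sumℤ-map-range1 f zero    = refl
sumℤ-map-range1 f (suc n) = begin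
  sumℤ (map f (range1 n ++ [ suc n ]))               ≡⟨ cong sumℤ (LP.map-++ f (range1 n) [ suc n ]) ⟩
  sumℤ (map f (range1 n) ++ [ f (suc n) ])           ≡⟨ sumℤ-++ (map f (range1 n)) [ f (suc n) ] ⟩
  sumℤ (map f (range1 n)) + (f (suc n) + + 0)        ≡⟨ cong₂ _+_ (sumℤ-map-range1 f n) (ℤP.+-identityʳ (f (suc n))) ⟩
  ∑[ i < n ] f (suc (toℕ i)) + f (suc n)             ≡⟨ sym (∑-last (f ∘ suc) n) ⟩
  ∑[ i ≤ n ] f (suc (toℕ i))                         ∎
  where open ≡-Reasoning

concatMap-range1-cong : ∀ {A : Set} {F G : ℕ → List A} → (∀ i → F (suc i) ≡ G (suc i)) →
  ∀ n → concatMap F (range1 n) ≡ concatMap G (range1 n)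
concatMap-range1-cong             F≗G zero    = refl
concatMap-range1-cong {F = F} {G} F≗G (suc n) = trans (LP.concatMap-++ F (range1 n) [ suc n ])
  (trans (cong₂ _++_ (concatMap-range1-cong F≗G n) (cong (_++ []) (F≗G n)))
         (sym (LP.concatMap-++ G (range1 n) [ suc n ])))

compsF-fuel : ∀ {f g m} → m ≤ f → m ≤ g → compsF f m ≡ compsF g m
compsF-fuel {m = zero}                  _         _         = refl
compsF-fuel {suc f} {suc g} {m = suc m} (s≤s m≤f) (s≤s m≤g) = concatMap-range1-cong
  (λ i → cong (map (suc i ∷_)) (compsF-fuel (ℕP.≤-trans (ℕP.m∸n≤m m i) m≤f) (ℕP.≤-trans (ℕP.m∸n≤m m i) m≤g)))
  (suc m)

sumℤ-compositions-suc : ∀ (h : List ℕ → ℤ) n → sumℤ (map h (compositions (suc n))) ≡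
  ∑[ i < suc n ] sumℤ (map (h ∘ (suc (toℕ i) ∷_)) (compositions (n ∸ toℕ i)))
sumℤ-compositions-suc h n =
  trans (sumℤ-map-concatMap h (λ a → map (a ∷_) (compsF n (suc n ∸ a))) (range1 (suc n)))
  (trans (sumℤ-map-range1 (λ a → sumℤ (map h (map (a ∷_) (compsF n (suc n ∸ a))))) (suc n))
         (sum-cong-≗ {suc n} (λ i → cong sumℤ (trans (sym (LP.map-∘ {g = h} {f = suc (toℕ i) ∷_} (compsF n (n ∸ toℕ i))))
           (cong (map (h ∘ (suc (toℕ i) ∷_))) (compsF-fuel (ℕP.m∸n≤m n (toℕ i)) ℕP.≤-refl))))))

signedMultinomialSum : ℕ → ℤ
signedMultinomialSum m = sumℤ (map (λ α → sgn (length α) * + multinomial m α) (compositions m))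

weightedSignedMultinomialSum : (ℕ → ℕ) → ℕ → ℤ
weightedSignedMultinomialSum p m =
  sumℤ (map (λ α → sgn (length α) * + (multinomial m α ℕ.* sum (map p α))) (compositions m))

signedMultinomialSum-suc : ∀ n → signedMultinomialSum (suc n) ≡
  - ∑[ i < suc n ] (+ (suc n C suc (toℕ i)) * signedMultinomialSum (n ∸ toℕ i))
signedMultinomialSum-suc n = trans (sumℤ-compositions-suc _ n)
  (trans (sum-cong-≗ {suc n} first-part) (∑-neg (λ i → + c i * signedMultinomialSum (n ∸ toℕ i))))
  where
  c : Fin (suc n) → ℕ
  c i = suc n C suc (toℕ i)
  factor : ∀ i (α : List ℕ) → - sgn (length α) * + (c i ℕ.* multinomial (n ∸ toℕ i) α) ≡
                              - + c i * (sgn (length α) * + multinomial (n ∸ toℕ i) α)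
  factor i α = trans (cong (- sgn (length α) *_) (ℤP.pos-* (c i) (multinomial (n ∸ toℕ i) α)))
    (solve 3 (λ s c m → (:- s) :* (c :* m) := (:- c) :* (s :* m)) refl
      (sgn (length α)) (+ c i) (+ multinomial (n ∸ toℕ i) α))
  first-part : ∀ i → sumℤ (map (λ α → - sgn (length α) * + (c i ℕ.* multinomial (n ∸ toℕ i) α)) (compositions (n ∸ toℕ i)))
                     ≡ - (+ c i * signedMultinomialSum (n ∸ toℕ i))
  first-part i = trans (sumℤ-map-cong (factor i) (compositions (n ∸ toℕ i)))
    (trans (sumℤ-map-*ˡ (- + c i) _ (compositions (n ∸ toℕ i)))
           (sym (ℤP.neg-distribˡ-* (+ c i) (signedMultinomialSum (n ∸ toℕ i)))))

signedMultinomialSum≡sgn : signedMultinomialSum ≗ sgn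
signedMultinomialSum≡sgn = binomialTransform-injective transforms-agree
  where
  transforms-agree : ∀ n → binomialTransform signedMultinomialSum n ≡ binomialTransform sgn n
  transforms-agree zero    = refl
  transforms-agree (suc n) = begin
    binomialTransform signedMultinomialSum (suc n)   ≡⟨ binomialTransform-suc signedMultinomialSum n ⟩
    X + signedMultinomialSum (suc n)                 ≡⟨ cong (_+_ X) (signedMultinomialSum-suc n) ⟩
    X + - X                                          ≡⟨ ℤP.+-inverseʳ X ⟩
    + 0                                              ≡⟨ sym (binomialTransform-sgn n) ⟩
    binomialTransform sgn (suc n)                    ∎
    where
    open ≡-Reasoning
    X = ∑[ i < suc n ] (+ (suc n C suc (toℕ i)) * signedMultinomialSum (n ∸ toℕ i))

module _ (p : ℕ → ℕ) where

  private
    R = weightedSignedMultinomialSum p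
    A = signedMultinomialSum

  weightedSignedMultinomialSum-suc : ∀ n → R (suc n) ≡
    - ∑[ i < suc n ] (+ (suc n C suc (toℕ i)) * (+ p (suc (toℕ i)) * A (n ∸ toℕ i) + R (n ∸ toℕ i)))
  weightedSignedMultinomialSum-suc n = trans (sumℤ-compositions-suc _ n)
    (trans (sum-cong-≗ {suc n} first-part)
      (∑-neg (λ i → + c i * (+ p (suc (toℕ i)) * A (n ∸ toℕ i) + R (n ∸ toℕ i)))))
    where
    c : Fin (suc n) → ℕ
    c i = suc n C suc (toℕ i)
    factor : ∀ i (α : List ℕ) →
      - sgn (length α) * + ((c i ℕ.* multinomial (n ∸ toℕ i) α) ℕ.* (p (suc (toℕ i)) ℕ.+ sum (map p α))) ≡
      - + c i * (+ p (suc (toℕ i)) * (sgn (length α) * + multinomial (n ∸ toℕ i) α)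
                 + sgn (length α) * + (multinomial (n ∸ toℕ i) α ℕ.* sum (map p α)))
    factor i α = begin
      - s * + ((c i ℕ.* M) ℕ.* (p a ℕ.+ W))
        ≡⟨ cong (- s *_) (trans (ℤP.pos-* (c i ℕ.* M) (p a ℕ.+ W))
                                (cong₂ _*_ (ℤP.pos-* (c i) M) (ℤP.pos-+ (p a) W))) ⟩
      - s * ((+ c i * + M) * (+ p a + + W))
        ≡⟨ solve 5 (λ s c m q w → (:- s) :* ((c :* m) :* (q :+ w)) := (:- c) :* (q :* (s :* m) :+ s :* (m :* w))) refl
             s (+ c i) (+ M) (+ p a) (+ W) ⟩
      - + c i * (+ p a * (s * + M) + s * (+ M * + W))
        ≡⟨ cong (λ x → - + c i * (+ p a * (s * + M) + s * x)) (sym (ℤP.pos-* M W)) ⟩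
      - + c i * (+ p a * (s * + M) + s * + (M ℕ.* W)) ∎
      where
      open ≡-Reasoning
      s = sgn (length α)
      a = suc (toℕ i)
      M = multinomial (n ∸ toℕ i) α
      W = sum (map p α)
    first-part : ∀ i →
      sumℤ (map (λ α → - sgn (length α) * + ((c i ℕ.* multinomial (n ∸ toℕ i) α) ℕ.* (p (suc (toℕ i)) ℕ.+ sum (map p α))))
                (compositions (n ∸ toℕ i)))
      ≡ - (+ c i * (+ p (suc (toℕ i)) * A (n ∸ toℕ i) + R (n ∸ toℕ i)))
    first-part i = begin
      _ ≡⟨ sumℤ-map-cong (factor i) L ⟩
      sumℤ (map (λ α → - + c i * (+ p (suc (toℕ i)) * unweighted α + weighted α)) L)
        ≡⟨ sumℤ-map-*ˡ (- + c i) _ L ⟩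
      - + c i * sumℤ (map (λ α → + p (suc (toℕ i)) * unweighted α + weighted α) L)
        ≡⟨ cong (- + c i *_) (sumℤ-map-+ _ weighted L) ⟩
      - + c i * (sumℤ (map (λ α → + p (suc (toℕ i)) * unweighted α) L) + R (n ∸ toℕ i))
        ≡⟨ cong (λ x → - + c i * (x + R (n ∸ toℕ i))) (sumℤ-map-*ˡ (+ p (suc (toℕ i))) unweighted L) ⟩
      - + c i * (+ p (suc (toℕ i)) * A (n ∸ toℕ i) + R (n ∸ toℕ i))
        ≡⟨ sym (ℤP.neg-distribˡ-* (+ c i) _) ⟩
      - (+ c i * (+ p (suc (toℕ i)) * A (n ∸ toℕ i) + R (n ∸ toℕ i))) ∎
      where
      open ≡-Reasoning
      L = compositions (n ∸ toℕ i)
      unweighted weighted : List ℕ → ℤ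
      unweighted α = sgn (length α) * + multinomial (n ∸ toℕ i) α
      weighted α = sgn (length α) * + (multinomial (n ∸ toℕ i) α ℕ.* sum (map p α))

  binomialTransform-weightedSignedMultinomialSum : p 0 ≡ 0 → ∀ n →
    binomialTransform R n ≡ - (sgn n * binomialTransform (λ b → sgn b * + p b) n)
  binomialTransform-weightedSignedMultinomialSum p0 zero rewrite p0 = refl
  binomialTransform-weightedSignedMultinomialSum p0 (suc n) = begin
    binomialTransform R (suc n)                  ≡⟨ binomialTransform-suc R n ⟩
    X + R (suc n)                                ≡⟨ cong (_+_ X) (weightedSignedMultinomialSum-suc n) ⟩
    X + - ∑[ i < suc n ] (+ c i * (P i + R (n ∸ toℕ i)))
      ≡⟨ cong (λ y → X + - y) (trans (sum-cong-≗ {suc n} (λ i → ℤP.*-distribˡ-+ (+ c i) (P i) (R (n ∸ toℕ i))))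
                                       (∑-distrib-+ (λ i → + c i * P i) (λ i → + c i * R (n ∸ toℕ i)))) ⟩
    X + - (Y + X)                                ≡⟨ solve 2 (λ x y → x :+ :- (y :+ x) := :- y) refl X Y ⟩
    - Y                                          ≡⟨ cong -_ (sum-cong-≗ {suc n} signs) ⟩
    - ∑[ i < suc n ] (sgn (suc n) * (+ c i * w (suc (toℕ i))))
      ≡⟨ cong -_ (sym (*-distribˡ-sum (sgn (suc n)) (λ i → + c i * w (suc (toℕ i))))) ⟩
    - (sgn (suc n) * ∑[ i < suc n ] (+ c i * w (suc (toℕ i))))
      ≡⟨ cong (λ y → - (sgn (suc n) * y)) (sym drop-zero-term) ⟩
    - (sgn (suc n) * binomialTransform w (suc n)) ∎
    where
    open ≡-Reasoning
    w : ℕ → ℤ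
    w b = sgn b * + p b
    c : Fin (suc n) → ℕ
    c i = suc n C suc (toℕ i)
    P : Fin (suc n) → ℤ
    P i = + p (suc (toℕ i)) * A (n ∸ toℕ i)
    X = ∑[ i < suc n ] (+ c i * R (n ∸ toℕ i))
    Y = ∑[ i < suc n ] (+ c i * P i)

    signs : ∀ i → + c i * P i ≡ sgn (suc n) * (+ c i * w (suc (toℕ i)))
    signs i = begin
      + c i * (+ p (suc (toℕ i)) * A (n ∸ toℕ i))   ≡⟨ cong (λ y → + c i * (+ p (suc (toℕ i)) * y)) (signedMultinomialSum≡sgn (n ∸ toℕ i)) ⟩
      + c i * (+ p (suc (toℕ i)) * sgn (n ∸ toℕ i)) ≡⟨ cong (λ y → + c i * (+ p (suc (toℕ i)) * y)) (sgn-∸ (toℕ<n i)) ⟩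
      + c i * (+ p (suc (toℕ i)) * (sgn (suc n) * sgn (suc (toℕ i))))
        ≡⟨ solve 4 (λ c q s t → c :* (q :* (s :* t)) := s :* (c :* (t :* q))) refl
             (+ c i) (+ p (suc (toℕ i))) (sgn (suc n)) (sgn (suc (toℕ i))) ⟩
      sgn (suc n) * (+ c i * w (suc (toℕ i)))       ∎

    drop-zero-term : binomialTransform w (suc n) ≡ ∑[ i < suc n ] (+ c i * w (suc (toℕ i)))
    drop-zero-term = trans (cong (λ m → + 1 * (+ 1 * + m) + ∑[ i < suc n ] (+ c i * w (suc (toℕ i)))) p0)
                           (ℤP.+-identityˡ _)

-- At m = 0 the truncated m ∸ 1 is harmless because (0)_(j+1) = 0.
sgn[m∸1]*falling : ∀ m j → sgn (m ∸ 1) * + falling m (suc j) ≡ - signedFalling (suc j) m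
sgn[m∸1]*falling zero    j rewrite falling-vanishes {0} {j} z≤n = refl
sgn[m∸1]*falling (suc m) j =
  sym (trans (cong -_ (sym (ℤP.neg-distribˡ-* (sgn m) (+ falling (suc m) (suc j))))) (ℤP.neg-involutive _))

lhs≡-∑ : ∀ K m → lhs m K ≡ - ∑[ j < K ] (sgn (suc (toℕ j)) * + S K (suc (toℕ j)) * signedFalling (suc (toℕ j)) m)
lhs≡-∑ K m = begin
  sgn (m ∸ 1) * sumℤ (map t (range1 K))                    ≡⟨ cong (sgn (m ∸ 1) *_) (sumℤ-map-range1 t K) ⟩
  sgn (m ∸ 1) * ∑[ j < K ] t (suc (toℕ j))                  ≡⟨ *-distribˡ-sum {K} (sgn (m ∸ 1)) (t ∘ suc ∘ toℕ) ⟩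
  ∑[ j < K ] (sgn (m ∸ 1) * t (suc (toℕ j)))                ≡⟨ sum-cong-≗ {K} (rearrange ∘ toℕ) ⟩
  ∑[ j < K ] (- (c (toℕ j) * signedFalling (suc (toℕ j)) m))  ≡⟨ ∑-neg {K} (λ j → c (toℕ j) * signedFalling (suc (toℕ j)) m) ⟩
  - ∑[ j < K ] (c (toℕ j) * signedFalling (suc (toℕ j)) m)  ∎
  where
  open ≡-Reasoning
  t c : ℕ → ℤ
  t j = sgn j * + (S K j ℕ.* falling m j)
  c j = sgn (suc j) * + S K (suc j)
  rearrange : ∀ j → sgn (m ∸ 1) * t (suc j) ≡ - (c j * signedFalling (suc j) m)
  rearrange j = begin
    sgn (m ∸ 1) * (sgn (suc j) * + (S K (suc j) ℕ.* falling m (suc j)))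
      ≡⟨ cong (λ x → sgn (m ∸ 1) * (sgn (suc j) * x)) (ℤP.pos-* (S K (suc j)) (falling m (suc j))) ⟩
    sgn (m ∸ 1) * (sgn (suc j) * (+ S K (suc j) * + falling m (suc j)))
      ≡⟨ solve 4 (λ a s k f → a :* (s :* (k :* f)) := (s :* k) :* (a :* f)) refl
           (sgn (m ∸ 1)) (sgn (suc j)) (+ S K (suc j)) (+ falling m (suc j)) ⟩
    c j * (sgn (m ∸ 1) * + falling m (suc j))   ≡⟨ cong (c j *_) (sgn[m∸1]*falling m j) ⟩
    c j * - signedFalling (suc j) m             ≡⟨ sym (ℤP.neg-distribʳ-* (c j) _) ⟩
    - (c j * signedFalling (suc j) m)           ∎

sgn*pow≡∑S*signedFalling : ∀ k b →
  sgn b * + (b ^ suc k) ≡ ∑[ j < suc k ] (+ S (suc k) (suc (toℕ j)) * signedFalling (suc (toℕ j)) b)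
sgn*pow≡∑S*signedFalling k b = begin
  sgn b * + (b ^ suc k)                           ≡⟨ cong (sgn b *_) (pow≡∑S*falling b {suc k} ℕP.≤-refl) ⟩
  sgn b * (+ 0 + ∑[ j < suc k ] term (toℕ j))     ≡⟨ cong (sgn b *_) (ℤP.+-identityˡ (∑[ j < suc k ] term (toℕ j))) ⟩
  sgn b * ∑[ j < suc k ] term (toℕ j)             ≡⟨ *-distribˡ-sum {suc k} (sgn b) (term ∘ toℕ) ⟩
  ∑[ j < suc k ] (sgn b * term (toℕ j))
    ≡⟨ sum-cong-≗ {suc k} (λ j → x*[y*z]≡y*[x*z] (sgn b) (+ S (suc k) (suc (toℕ j))) (+ falling b (suc (toℕ j)))) ⟩
  ∑[ j < suc k ] (+ S (suc k) (suc (toℕ j)) * signedFalling (suc (toℕ j)) b) ∎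
  where
  open ≡-Reasoning
  term : ℕ → ℤ
  term j = + S (suc k) (suc j) * + falling b (suc j)

binomialTransform-lhs : ∀ k n →
  binomialTransform (λ m → lhs m (suc k)) n ≡ - (sgn n * binomialTransform (λ b → sgn b * + (b ^ suc k)) n)
binomialTransform-lhs k n = begin
  binomialTransform (λ m → lhs m K) n
    ≡⟨ binomialTransform-cong (lhs≡-∑ K) n ⟩
  binomialTransform (λ m → - ∑[ j < K ] (sgn (j′ j) * s j * g j m)) n
    ≡⟨ binomialTransform-neg (λ m → ∑[ j < K ] (sgn (j′ j) * s j * g j m)) n ⟩
  - binomialTransform (λ m → ∑[ j < K ] (sgn (j′ j) * s j * g j m)) n
    ≡⟨ cong -_ (binomialTransform-∑ (λ j m → sgn (j′ j) * s j * g j m) n) ⟩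
  - ∑[ j < K ] binomialTransform (λ m → sgn (j′ j) * s j * g j m) n
    ≡⟨ cong -_ (sum-cong-≗ {K} (λ j → trans (binomialTransform-*ˡ (sgn (j′ j) * s j) (g j) n) (signs j))) ⟩
  - ∑[ j < K ] (sgn n * (s j * binomialTransform (g j) n))
    ≡⟨ cong -_ (sym (*-distribˡ-sum {K} (sgn n) (λ j → s j * binomialTransform (g j) n))) ⟩
  - (sgn n * ∑[ j < K ] (s j * binomialTransform (g j) n))
    ≡⟨ cong (λ x → - (sgn n * x)) (sym (trans (binomialTransform-∑ (λ j b → s j * g j b) n)
                                              (sum-cong-≗ {K} (λ j → binomialTransform-*ˡ (s j) (g j) n)))) ⟩
  - (sgn n * binomialTransform (λ b → ∑[ j < K ] (s j * g j b)) n)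
    ≡⟨ cong (λ x → - (sgn n * x)) (binomialTransform-cong (sym ∘ sgn*pow≡∑S*signedFalling k) n) ⟩
  - (sgn n * binomialTransform (λ b → sgn b * + (b ^ K)) n) ∎
  where
  open ≡-Reasoning
  K = suc k
  j′ : Fin K → ℕ
  j′ j = suc (toℕ j)
  s : Fin K → ℤ
  s j = + S K (j′ j)
  g : Fin K → ℕ → ℤ
  g j = signedFalling (j′ j)
  signs : ∀ j → sgn (j′ j) * s j * binomialTransform (g j) n ≡ sgn n * (s j * binomialTransform (g j) n)
  signs j = begin
    sgn (j′ j) * s j * binomialTransform (g j) n    ≡⟨ solve 3 (λ a b c → a :* b :* c := b :* (a :* c)) refl (sgn (j′ j)) (s j) _ ⟩
    s j * (sgn (j′ j) * binomialTransform (g j) n)  ≡⟨ cong (s j *_) (sym (sgn*binomialTransform-signedFalling (j′ j) n)) ⟩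
    s j * (sgn n * binomialTransform (g j) n)       ≡⟨ x*[y*z]≡y*[x*z] (s j) (sgn n) _ ⟩
    sgn n * (s j * binomialTransform (g j) n)       ∎

lhs≡rhs : ∀ n k → lhs n (suc k) ≡ rhs n (suc k)
lhs≡rhs n k = binomialTransform-injective {λ m → lhs m (suc k)} {λ m → rhs m (suc k)} transforms-agree n
  where
  transforms-agree : ∀ m → binomialTransform (λ m → lhs m (suc k)) m ≡ binomialTransform (λ m → rhs m (suc k)) m
  transforms-agree m = trans (binomialTransform-lhs k m)
    (sym (binomialTransform-weightedSignedMultinomialSum (_^ suc k) refl m))

corollary5p3 : (n : ℕ) → n ≥ 1 → (k : ℕ) → k ≥ 1 → lhs n k ≡ rhs n k
corollary5p3 n _ (suc k) _ = lhs≡rhs n k
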